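{- Let $\mathcal C$ be a set of frame conditions. The following rules are admissible in $\mathsf{N}\mathsf{Q}^{\circ}_{=}.\mathsf{K}(\mathcal{C})$ (for any context $\mathcal G\{\}$ and terms $t,s,r$): (sym) from $\mathcal G\{t\neq s,s\neq t\}$ infer $\mathcal G\{t\neq s\}$; (tra) from $\mathcal G\{t\neq s,s\neq r,t\neq r\}$ infer $\mathcal G\{t\neq s,s\neq r\}$.
   Context: Syntax. Terms are variables or constants. Formulas (negation normal form): $\phi ::= P(\vec t)\mid \neg P(\vec t)\mid t=s\mid t\neq s\mid \phi\lor\phi\mid\phi\land\phi\mid\exists x\phi\mid\forall x\phi\mid\Diamond\phi\mid\Box\phi$ ($P$ an $n$-ary predicate, $n\ge 0$). A literal is $P(\vec t)$, $\neg P(\vec t)$, $t=s$ or $t\neq s$; a negative literal is $\neg P(\vec t)$ or $t\neq s$. The negation $\overline{\phi}$ swaps $P(\vec t)/\neg P(\vec t)$, $=/\neq$, $\lor/\land$, $\exists/\forall$, $\Diamond/\Box$ (De Morgan duals). $\phi(t/x)$ is capture-avoiding substitution for free occurrences; formulas differing only in bound variable names are identified. Frames. A frame is $\langle W,R,U,D\rangle$ with $W\neq\emptyset$, $R\subseteq W\times W$, $U\neq\emptyset$ and $D_w\subseteq U$ for each $w\in W$. Frame conditions: $\mathbf D$: every $w$ has some $u$ with $wRu$; $\mathbf G(n,k)$ ($n,k\in\mathbb N$): $wR^nu$ and $wR^kv$ imply $uRv$ ($R^0$ = identity); $\mathbf{ID}$: $wRv\Rightarrow D_w\subseteq D_v$;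 $\mathbf{DD}$: $wRv\Rightarrow D_v\subseteq D_w$; $\mathbf{CD}$: $D_w=U$ for all $w$; $\mathbf{NE}$: $D_w\neq\emptyset$ for all $w$. $\mathcal C$ is a set of such conditions, assumed closed: if one of these conditions holds on every frame satisfying all of $\mathcal C$, it belongs to $\mathcal C$. $\mathbf G$ denotes the set of all $\mathbf G(n,k)\in\mathcal C$. Grammars. Characters $\mathsf f$, $\mathsf b$. A $\Sigma$-system $S$ is a set of productions $c\to s$, $c\in\{\mathsf f,\mathsf b\}$, $s$ a string over $\{\mathsf f,\mathsf b\}$; $s'cr'\to s'sr'$ is a one-step derivation, $\to^*_S$ its reflexive-transitive closure, $L_S(s)=\{t: s\to^*_S t\}$. $S(\mathbf G)$ contains $\mathsf f\to\mathsf b^n\mathsf f^k$ and $\mathsf b\to\mathsf b^k\mathsf f^n$ for each $\mathbf G(n,k)\in\mathbf G$; $S4=\{\mathsf f\to\varepsilon,\mathsf b\to\varepsilon,\mathsf f\to\mathsf f\mathsf f,\mathsf b\to\mathsf b\mathsf b\}$; $S5=\{\mathsf f\to\varepsilon,\mathsf b\to\varepsilon,\mathsf f\to\mathsf b\mathsf f,\mathsf b\to\mathsf b\mathsf f\}$. Nested sequents. A flat sequent is $\vec t,\vec\phi$: a finite multiset $\vec t$ of terms (signature) and a finite multiset $\vec\phi$ of formulas. A nested sequent is $\Gamma,[\mathcal H_1],\dots,[\mathcal H_n]$ ($n\ge 0$) with $\Gamma$ flat and $\mathcal H_i$ nested sequents; it is a tree of flat sequents (components), each with a unique name, $\Gamma$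 being the root and the roots of the $\mathcal H_i$ its children. A context $\mathcal G\{\}$ has a hole in a component; $\mathcal G\{\mathcal H\}$ fills it, $\mathcal G\{\emptyset\}$ removes it; $\mathcal G\{\cdot\}_{w}\{\cdot\}_{u}$ indicates holes in the components named $w,u$. Propagation: for each parent $w$ and child $u$ we have $w\xrightarrow{\mathsf f}u$ and $u\xrightarrow{\mathsf b}w$; $w\xrightarrow{c_1\cdots c_m}u$ means there are components $w=v_0,\dots,v_m=u$ with $v_{i-1}\xrightarrow{c_i}v_i$ ($w=u$ for the empty string); $w\xrightarrow{L}u$ means $w\xrightarrow{s}u$ for some $s\in L$. Calculus. Rules (premises $\Rightarrow$ conclusion): (ax) $\Rightarrow\mathcal G\{L,\overline L\}$, $L$ a literal; ($\lor$) $\mathcal G\{\phi,\psi\}\Rightarrow\mathcal G\{\phi\lor\psi\}$; ($\land$) $\mathcal G\{\phi\}$, $\mathcal G\{\psi\}\Rightarrow\mathcal G\{\phi\land\psi\}$; ($\exists$) $\mathcal G\{t,\exists x\psi,\psi(t/x)\}\Rightarrow\mathcal G\{t,\exists x\psi\}$; ($\forall$) $\mathcal G\{y,\phi(y/x)\}\Rightarrow\mathcal G\{\forall x\phi\}$, $y$ a variable not free in the conclusion; ($\Diamond$) $\mathcal G\{\Diamond\phi\}_w\{\phi\}_u\Rightarrow\mathcal G\{\Diamond\phi\}_w\{\emptyset\}_u$ provided $w\xrightarrow{L}u$, $L=L_{S(\mathbf G)}(\mathsf f)$; ($\Box$) $\mathcal G\{[\phi]\}\Rightarrow\mathcal G\{\Box\phi\}$;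 (ref) $\mathcal G\{t\neq t\}\Rightarrow\mathcal G\{\emptyset\}$; (rep) $\mathcal G\{t\neq s,N(t/z),N(s/z)\}\Rightarrow\mathcal G\{t\neq s,N(t/z)\}$, $N$ a negative literal; (drep) $\mathcal G\{s,t,t\neq s\}\Rightarrow\mathcal G\{t,t\neq s\}$; (rig) $\mathcal G\{s\neq t\}_w\{s\neq t\}_u\Rightarrow\mathcal G\{s\neq t\}_w\{\emptyset\}_u$, $w\neq u$; (dp) $\mathcal G\{t\}_w\{t\}_u\Rightarrow\mathcal G\{t\}_w\{\emptyset\}_u$, $w\neq u$, $w\xrightarrow{L}u$ with $L=L_{S4\cup S(\mathbf G)}(\mathsf f)$ if $\mathbf{ID}\in\mathcal C,\mathbf{DD}\notin\mathcal C$, $L=L_{S4\cup S(\mathbf G)}(\mathsf b)$ if $\mathbf{DD}\in\mathcal C,\mathbf{ID}\notin\mathcal C$, $L=L_{S5}(\mathsf f)$ if both; (d) $\mathcal G\{[\emptyset]\}\Rightarrow\mathcal G\{\emptyset\}$; (nd) $\mathcal G\{y\}\Rightarrow\mathcal G\{\emptyset\}$, $y$ a variable not free in the conclusion; (cd) $\mathcal G\{t\}\Rightarrow\mathcal G\{\emptyset\}$. $\mathsf N\mathsf Q^\circ_=.\mathsf K(\mathcal C)$ consists of ax, $\lor$, $\land$, $\exists$, $\forall$, $\Diamond$, $\Box$, ref, rep, drep, rig, plus dp iff $\mathcal C\cap\{\mathbf{ID},\mathbf{DD}\}\neq\emptyset$, nd iff $\mathbf{NE}\in\mathcal C$, cd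 iff $\mathbf{CD}\in\mathcal C$, d iff $\mathbf D\in\mathcal C$. A proof is a finite tree of nested sequents whose nodes are conclusions of rule instances with their children as premises and whose leaves are ax instances. A rule is admissible if whenever its premises are provable, its conclusion is provable. -}

module Defs where

open import Level using (0ℓ)
open import Data.Nat using (ℕ; zero; suc; _≡ᵇ_)
open import Data.Fin using (Fin; zero; suc)
open import Data.Bool using (if_then_else_)
open import Data.List using (List; []; _∷_; _++_; _∷ʳ_; replicate; map; concatMap)
open import Data.List.Membership.Propositional using (_∉_)
open import Data.List.Relation.Binary.Permutation.Propositional using (_↭_)
open import Data.List.Relation.Binary.Permutation.Homogeneous using (Permutation)
open import Data.Product using (Σ; _×_; _,_)
open import Data.Sum using (_⊎_)
open import Relation.Nullary using (¬_)
open import Relation.Binary.PropositionalEquality using (_≡_; _≢_)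
open import Relation.Binary.Construct.Closure.ReflexiveTransitive using (Star)

data Term : Set where
  var : ℕ → Term
  con : ℕ → Term

-- Term positions inside a formula with n bound variables in scope:
-- bound variables are de Bruijn indices (so alpha-equivalent formulas are
-- literally equal); free positions hold named terms.
data Tm (n : ℕ) : Set where
  bnd : Fin n → Tm n
  fr  : Term → Tm n

-- Formulas in negation normal form.  A predicate symbol is given by a
-- name (ℕ); its arity is the length of the argument list.
data Formula (n : ℕ) : Set where
  pr npr   : ℕ → List (Tm n) → Formula n
  eq neq   : Tm n → Tm n → Formula n
  or and   : Formula n → Formula n → Formula n
  ex all   : Formula (suc n) → Formula n
  dia box  : Formula n → Formula n

Fml : Set
Fml = Formula 0

neg : ∀ {n} → Formula n → Formula n
neg (pr P ts)  = npr P ts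
neg (npr P ts) = pr P ts
neg (eq t s)   = neq t s
neg (neq t s)  = eq t s
neg (or φ ψ)   = and (neg φ) (neg ψ)
neg (and φ ψ)  = or (neg φ) (neg ψ)
neg (ex φ)     = all (neg φ)
neg (all φ)    = ex (neg φ)
neg (dia φ)    = box (neg φ)
neg (box φ)    = dia (neg φ)

data IsLiteral : Fml → Set where
  l-pr  : ∀ P ts → IsLiteral (pr P ts)
  l-npr : ∀ P ts → IsLiteral (npr P ts)
  l-eq  : ∀ t s  → IsLiteral (eq t s)
  l-neq : ∀ t s  → IsLiteral (neq t s)

data IsNegLiteral : Fml → Set where
  n-npr : ∀ P ts → IsNegLiteral (npr P ts)
  n-neq : ∀ t s  → IsNegLiteral (neq t s)

weakenTm : ∀ {n} → Tm n → Tm (suc n)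
weakenTm (bnd i) = bnd (suc i)
weakenTm (fr t)  = fr t

liftσ : ∀ {m n} → (Tm m → Tm n) → Tm (suc m) → Tm (suc n)
liftσ σ (bnd zero)    = bnd zero
liftσ σ (bnd (suc i)) = weakenTm (σ (bnd i))
liftσ σ (fr t)        = weakenTm (σ (fr t))

mapF : ∀ {m n} → (Tm m → Tm n) → Formula m → Formula n
mapF σ (pr P ts)  = pr P (map σ ts)
mapF σ (npr P ts) = npr P (map σ ts)
mapF σ (eq t s)   = eq (σ t) (σ s)
mapF σ (neq t s)  = neq (σ t) (σ s)
mapF σ (or φ ψ)   = or (mapF σ φ) (mapF σ ψ)
mapF σ (and φ ψ)  = and (mapF σ φ) (mapF σ ψ)
mapF σ (ex φ)     = ex (mapF (liftσ σ) φ)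
mapF σ (all φ)    = all (mapF (liftσ σ) φ)
mapF σ (dia φ)    = dia (mapF σ φ)
mapF σ (box φ)    = box (mapF σ φ)

instTm : ∀ {n} → Term → Tm (suc n) → Tm n
instTm t (bnd zero)    = fr t
instTm t (bnd (suc i)) = bnd i
instTm t (fr u)        = fr u

inst : ∀ {n} → Formula (suc n) → Term → Formula n
inst φ t = mapF (instTm t) φ

substTm : ∀ {n} → ℕ → Term → Tm n → Tm n
substTm z t (bnd i)       = bnd i
substTm z t (fr (var y))  = if y ≡ᵇ z then fr t else fr (var y)
substTm z t (fr (con c))  = fr (con c)

subst : ∀ {n} → Formula n → ℕ → Term → Formula n
subst φ z t = mapF (substTm z t) φ

fvTerm : Term → List ℕ
fvTerm (var y) = y ∷ []
fvTerm (con c) = []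

fvTm : ∀ {n} → Tm n → List ℕ
fvTm (bnd i) = []
fvTm (fr t)  = fvTerm t

fvF : ∀ {n} → Formula n → List ℕ
fvF (pr P ts)  = concatMap fvTm ts
fvF (npr P ts) = concatMap fvTm ts
fvF (eq t s)   = fvTm t ++ fvTm s
fvF (neq t s)  = fvTm t ++ fvTm s
fvF (or φ ψ)   = fvF φ ++ fvF ψ
fvF (and φ ψ)  = fvF φ ++ fvF ψ
fvF (ex φ)     = fvF φ
fvF (all φ)    = fvF φ
fvF (dia φ)    = fvF φ
fvF (box φ)    = fvF φ

_≠_ : Term → Term → Fml
t ≠ s = neq (fr t) (fr s)

record Frame : Set₁ where
  field
    W  : Set
    R  : W → W → Set
    U  : Set
    D  : W → U → Set
    w₀ : W                -- W ≠ ∅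
    u₀ : U                -- U ≠ ∅

data Cond : Set where
  condD  : Cond
  condG  : ℕ → ℕ → Cond
  condID condDD condCD condNE : Cond

module _ (F : Frame) where
  open Frame F

  Rpow : ℕ → W → W → Set
  Rpow zero    w u = w ≡ u
  Rpow (suc n) w u = Σ W λ v → R w v × Rpow n v u

  Holds : Cond → Set
  Holds condD      = ∀ w → Σ W λ u → R w u
  Holds (condG n k) = ∀ w u v → Rpow n w u → Rpow k w v → R u v
  Holds condID     = ∀ w v → R w v → ∀ x → D w x → D v x
  Holds condDD     = ∀ w v → R w v → ∀ x → D v x → D w x
  Holds condCD     = ∀ w x → D w x
  Holds condNE     = ∀ w → Σ U λ x → D w x

CondSet : Set₁
CondSet = Cond → Set

Closed : CondSet → Set₁
Closed 𝒞 = ∀ c → (∀ (F : Frame) → (∀ c' → 𝒞 c' → Holds F c') → Holds F c) → 𝒞 c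

data Ch : Set where
  cf cb : Ch

-- A Σ-system: a set of productions c → s
System : Set₁
System = Ch → List Ch → Set

_∪S_ : System → System → System
(P ∪S Q) c s = P c s ⊎ Q c s

data SG (𝒞 : CondSet) : System where
  f-prod : ∀ {n k} → 𝒞 (condG n k) → SG 𝒞 cf (replicate n cb ++ replicate k cf)
  b-prod : ∀ {n k} → 𝒞 (condG n k) → SG 𝒞 cb (replicate k cb ++ replicate n cf)

data S4 : System where
  f-ε  : S4 cf []
  b-ε  : S4 cb []
  f-ff : S4 cf (cf ∷ cf ∷ [])
  b-bb : S4 cb (cb ∷ cb ∷ [])

data S5 : System where
  f-ε  : S5 cf []
  b-ε  : S5 cb []
  f-bf : S5 cf (cb ∷ cf ∷ [])
  b-bf : S5 cb (cb ∷ cf ∷ [])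

data Step1 (S : System) : List Ch → List Ch → Set where
  step : ∀ {c s} s' r' → S c s → Step1 S (s' ++ c ∷ r') (s' ++ s ++ r')

Lang : System → Ch → List Ch → Set
Lang S c t = Star (Step1 S) (c ∷ []) t

-- node ts fs hs  =  ts, fs, [h₁], …, [hₙ]   (lists read as multisets)
data NSeq : Set where
  node : List Term → List Fml → List NSeq → NSeq

∅ : NSeq
∅ = node [] [] []

flat : List Term → List Fml → NSeq
flat ts fs = node ts fs []

fvS  : NSeq → List ℕ
fvSs : List NSeq → List ℕ
fvS (node ts fs hs) = concatMap fvTerm ts ++ concatMap fvF fs ++ fvSs hs
fvSs []       = []
fvSs (h ∷ hs) = fvS h ++ fvSs hs

data _≈_ : NSeq → NSeq → Set where
  node≈ : ∀ {ts ts' fs fs' hs hs'} → ts ↭ ts' → fs ↭ fs' →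
          Permutation _≈_ hs hs' → node ts fs hs ≈ node ts' fs' hs'

-- Component names: a component is named by its path of child indices
-- from the root.
Pos : Set
Pos = List ℕ

-- Add p H G S :  S = G{H} with the hole in the component p of G
--   (G{∅} = G; the root of H is merged into the component, the children
--    of H become new children of it).
data Add  : Pos → NSeq → NSeq → NSeq → Set
data AddL : ℕ → Pos → NSeq → List NSeq → List NSeq → Set
data Add where
  here : ∀ {ts fs hs ts₀ fs₀ hs₀} →
         Add [] (node ts fs hs) (node ts₀ fs₀ hs₀) (node (ts₀ ++ ts) (fs₀ ++ fs) (hs₀ ++ hs))
  down : ∀ {i p H ts fs hs hs'} → AddL i p H hs hs' →
         Add (i ∷ p) H (node ts fs hs) (node ts fs hs')
data AddL where
  hd : ∀ {p H h h' hs} → Add p H h h' → AddL zero p H (h ∷ hs) (h' ∷ hs)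
  tl : ∀ {i p H h hs hs'} → AddL i p H hs hs' → AddL (suc i) p H (h ∷ hs) (h ∷ hs')

data Valid  : NSeq → Pos → Set
data ValidL : List NSeq → ℕ → Pos → Set
data Valid where
  root : ∀ {S} → Valid S []
  down : ∀ {ts fs hs i p} → ValidL hs i p → Valid (node ts fs hs) (i ∷ p)
data ValidL where
  hd : ∀ {h hs p} → Valid h p → ValidL (h ∷ hs) zero p
  tl : ∀ {h hs i p} → ValidL hs i p → ValidL (h ∷ hs) (suc i) p

data Edge (S : NSeq) : Ch → Pos → Pos → Set where
  fwd : ∀ {p i} → Valid S (p ∷ʳ i) → Edge S cf p (p ∷ʳ i)
  bwd : ∀ {p i} → Valid S (p ∷ʳ i) → Edge S cb (p ∷ʳ i) p

data Walk (S : NSeq) : List Ch → Pos → Pos → Set where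
  nil  : ∀ {p} → Valid S p → Walk S [] p p
  cons : ∀ {c s p q r} → Edge S c p q → Walk S s q r → Walk S (c ∷ s) p r

data DPLang (𝒞 : CondSet) (s : List Ch) : Set where
  onlyID : 𝒞 condID → ¬ 𝒞 condDD → Lang (S4 ∪S SG 𝒞) cf s → DPLang 𝒞 s
  onlyDD : 𝒞 condDD → ¬ 𝒞 condID → Lang (S4 ∪S SG 𝒞) cb s → DPLang 𝒞 s
  both   : 𝒞 condID → 𝒞 condDD → Lang S5 cf s → DPLang 𝒞 s

-- In each rule, the conclusion/premises are G{…} for a context given by
-- a base sequent G (= G{∅}) and a hole position w.
data Prov (𝒞 : CondSet) : NSeq → Set where
  ax   : ∀ {w G S L} → IsLiteral L →
         Add w (flat [] (L ∷ neg L ∷ [])) G S → Prov 𝒞 S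
  ∨R   : ∀ {w G S S' φ ψ} →
         Add w (flat [] (or φ ψ ∷ [])) G S → Add w (flat [] (φ ∷ ψ ∷ [])) G S' →
         Prov 𝒞 S' → Prov 𝒞 S
  ∧R   : ∀ {w G S S₁ S₂ φ ψ} →
         Add w (flat [] (and φ ψ ∷ [])) G S →
         Add w (flat [] (φ ∷ [])) G S₁ → Add w (flat [] (ψ ∷ [])) G S₂ →
         Prov 𝒞 S₁ → Prov 𝒞 S₂ → Prov 𝒞 S
  ∃R   : ∀ {w G S S' t ψ} →
         Add w (flat (t ∷ []) (ex ψ ∷ [])) G S →
         Add w (flat (t ∷ []) (ex ψ ∷ inst ψ t ∷ [])) G S' →
         Prov 𝒞 S' → Prov 𝒞 S
  ∀R   : ∀ {w G S S' y φ} →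
         Add w (flat [] (all φ ∷ [])) G S →
         Add w (flat (var y ∷ []) (inst φ (var y) ∷ [])) G S' →
         y ∉ fvS S → Prov 𝒞 S' → Prov 𝒞 S
  ◇R   : ∀ {w u G S S' φ s} →
         Add w (flat [] (dia φ ∷ [])) G S → Walk S s w u → Lang (SG 𝒞) cf s →
         Add u (flat [] (φ ∷ [])) S S' → Prov 𝒞 S' → Prov 𝒞 S
  □R   : ∀ {w G S S' φ} →
         Add w (flat [] (box φ ∷ [])) G S →
         Add w (node [] [] (flat [] (φ ∷ []) ∷ [])) G S' →
         Prov 𝒞 S' → Prov 𝒞 S
  ref  : ∀ {w S S' t} →
         Add w (flat [] (t ≠ t ∷ [])) S S' → Prov 𝒞 S' → Prov 𝒞 S
  rep  : ∀ {w G S S' t s N z} → IsNegLiteral N →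
         Add w (flat [] (t ≠ s ∷ subst N z t ∷ [])) G S →
         Add w (flat [] (t ≠ s ∷ subst N z t ∷ subst N z s ∷ [])) G S' →
         Prov 𝒞 S' → Prov 𝒞 S
  drep : ∀ {w G S S' t s} →
         Add w (flat (t ∷ []) (t ≠ s ∷ [])) G S →
         Add w (flat (s ∷ t ∷ []) (t ≠ s ∷ [])) G S' →
         Prov 𝒞 S' → Prov 𝒞 S
  rig  : ∀ {w u G S S' t s} → w ≢ u →
         Add w (flat [] (s ≠ t ∷ [])) G S →
         Add u (flat [] (s ≠ t ∷ [])) S S' → Prov 𝒞 S' → Prov 𝒞 S
  dp   : ∀ {w u G S S' t s} → w ≢ u →
         Add w (flat (t ∷ []) []) G S → Walk S s w u → DPLang 𝒞 s →
         Add u (flat (t ∷ []) []) S S' → Prov 𝒞 S' → Prov 𝒞 S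
  d    : ∀ {w S S'} → 𝒞 condD →
         Add w (node [] [] (∅ ∷ [])) S S' → Prov 𝒞 S' → Prov 𝒞 S
  nd   : ∀ {w S S' y} → 𝒞 condNE → y ∉ fvS S →
         Add w (flat (var y ∷ []) []) S S' → Prov 𝒞 S' → Prov 𝒞 S
  cd   : ∀ {w S S' t} → 𝒞 condCD →
         Add w (flat (t ∷ []) []) S S' → Prov 𝒞 S' → Prov 𝒞 S
  -- sequents are multisets (of terms, formulas and bracketed children)
  mset : ∀ {S S'} → S ≈ S' → Prov 𝒞 S → Prov 𝒞 S'

SymAdmissible : CondSet → Set
SymAdmissible 𝒞 = ∀ (w : Pos) (G S S' : NSeq) (t s : Term) →
  Add w (flat [] (t ≠ s ∷ s ≠ t ∷ [])) G S' →
  Add w (flat [] (t ≠ s ∷ [])) G S →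
  Prov 𝒞 S' → Prov 𝒞 S

TraAdmissible : CondSet → Set
TraAdmissible 𝒞 = ∀ (w : Pos) (G S S' : NSeq) (t s r : Term) →
  Add w (flat [] (t ≠ s ∷ s ≠ r ∷ t ≠ r ∷ [])) G S' →
  Add w (flat [] (t ≠ s ∷ s ≠ r ∷ [])) G S →
  Prov 𝒞 S' → Prov 𝒞 S

-- (tra) is a single instance of (rep) with the negative literal t ≠ z, z fresh: from s ≠ r
-- and t ≠ s it adds t ≠ r.  (sym) is (rep) with z ≠ t, which turns t ≠ s and t ≠ t into
-- s ≠ t; the literal t ≠ t is then removed by (ref), and inserted into the premise by
-- weakening.  Weakening by formulas whose free variables are free in a literal already
-- present is admissible by induction on proofs: such a literal is never principal in a rule
-- that removes it, so it survives in every premise and keeps the eigenvariable conditions of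
-- (∀) and (nd) intact.
module Submission where

open import Defs
open import Data.Product using (Σ; _×_; _,_)
open import Data.Nat using (ℕ; zero; suc; _≡ᵇ_)
open import Data.Bool using (true; false)
open import Data.Empty using (⊥-elim)
open import Data.Sum using (_⊎_; inj₁; inj₂; [_,_]′)
open import Function using (id; _∘_)
open import Data.List using (List; []; _∷_; _++_; concatMap)
import Data.List.Properties as List
open import Data.List.Membership.Propositional using (_∈_; _∉_)
open import Data.List.Membership.Propositional.Properties using (∈-++⁺ˡ; ∈-++⁺ʳ; ∈-++⁻; ∈-concatMap⁺)
open import Data.List.Relation.Unary.Any using (here; there)
import Data.List.Relation.Unary.Any as Any
open import Data.List.Relation.Binary.Subset.Propositional using (_⊆_)
open import Data.List.Relation.Binary.Permutation.Propositional
  using (_↭_; ↭-refl; ↭-sym; ↭-trans; ↭-prep; ↭-swap)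
import Data.List.Relation.Binary.Permutation.Propositional.Properties as ↭
open import Data.List.Relation.Binary.Permutation.Homogeneous using (Permutation)
import Data.List.Relation.Binary.Permutation.Homogeneous as Perm
open import Data.List.Relation.Binary.Pointwise.Base using (Pointwise; []; _∷_)
open import Relation.Nullary using (¬_)
open import Relation.Binary.PropositionalEquality
  using (_≡_; refl; sym; trans; cong; cong₂; subst₂) renaming (subst to ≡-subst)

private
  module ↭-Solver {A : Set} where
    open import Algebra.Solver.CommutativeMonoid (↭.++-commutativeMonoid {A = A}) public
      using (solve; _⊜_; _⊕_)
  open ↭-Solver

  ++-swapʳ : ∀ {A : Set} (a b c : List A) → (a ++ b) ++ c ↭ (a ++ c) ++ b
  ++-swapʳ = solve 3 (λ a b c → (a ⊕ b) ⊕ c ⊜ (a ⊕ c) ⊕ b) ↭-refl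

  ++-interchange : ∀ {A : Set} (a b c d : List A) → (a ++ b) ++ (c ++ d) ↭ (a ++ c) ++ (b ++ d)
  ++-interchange = solve 4 (λ a b c d → (a ⊕ b) ⊕ (c ⊕ d) ⊜ (a ⊕ c) ⊕ (b ⊕ d)) ↭-refl

  ++-assoc↭ : ∀ {A : Set} (a b c : List A) → a ++ (b ++ c) ↭ (a ++ b) ++ c
  ++-assoc↭ a b c = ↭-sym (↭.++-assoc a b c)

-- Like ≈, but children are never reordered, so that positions of components are preserved.

data _≋_ : NSeq → NSeq → Set
data _≋*_ : List NSeq → List NSeq → Set
data _≋_ where
  node≋ : ∀ {ts ts' fs fs' hs hs'} → ts ↭ ts' → fs ↭ fs' → hs ≋* hs' → node ts fs hs ≋ node ts' fs' hs'
data _≋*_ where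
  [] : [] ≋* []
  _∷_ : ∀ {h h' hs hs'} → h ≋ h' → hs ≋* hs' → (h ∷ hs) ≋* (h' ∷ hs')

≋-refl : ∀ S → S ≋ S
≋*-refl : ∀ hs → hs ≋* hs
≋-refl (node ts fs hs) = node≋ ↭-refl ↭-refl (≋*-refl hs)
≋*-refl [] = []
≋*-refl (h ∷ hs) = ≋-refl h ∷ ≋*-refl hs

≋-reflexive : ∀ {S S'} → S ≡ S' → S ≋ S'
≋-reflexive {S} refl = ≋-refl S

≋*-reflexive : ∀ {hs hs'} → hs ≡ hs' → hs ≋* hs'
≋*-reflexive {hs} refl = ≋*-refl hs

≋-sym : ∀ {S S'} → S ≋ S' → S' ≋ S
≋*-sym : ∀ {hs hs'} → hs ≋* hs' → hs' ≋* hs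
≋-sym (node≋ p q l) = node≋ (↭-sym p) (↭-sym q) (≋*-sym l)
≋*-sym [] = []
≋*-sym (e ∷ l) = ≋-sym e ∷ ≋*-sym l

≋*-++ : ∀ {a a' b b'} → a ≋* a' → b ≋* b' → (a ++ b) ≋* (a' ++ b')
≋*-++ [] l = l
≋*-++ (e ∷ l) l' = e ∷ ≋*-++ l l'

≋⇒≈ : ∀ {S S'} → S ≋ S' → S ≈ S'
≋*⇒Pointwise : ∀ {hs hs'} → hs ≋* hs' → Pointwise _≈_ hs hs'
≋⇒≈ (node≋ p q l) = node≈ p q (Perm.refl (≋*⇒Pointwise l))
≋*⇒Pointwise [] = []
≋*⇒Pointwise (e ∷ l) = ≋⇒≈ e ∷ ≋*⇒Pointwise l

add-valid : ∀ {p X G S} → Add p X G S → Valid G p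
add-validL : ∀ {i p X hs hs'} → AddL i p X hs hs' → ValidL hs i p
add-valid here = root
add-valid (down a) = down (add-validL a)
add-validL (hd a) = hd (add-valid a)
add-validL (tl a) = tl (add-validL a)

add-exists : ∀ {G p} → Valid G p → ∀ X → Σ NSeq (Add p X G)
add-existsL : ∀ {hs i p} → ValidL hs i p → ∀ X → Σ (List NSeq) (AddL i p X hs)
add-exists {node _ _ _} root (node _ _ _) = _ , here
add-exists (down v) X with add-existsL v X
... | _ , a = _ , down a
add-existsL (hd v) X with add-exists v X
... | _ , a = _ , hd a
add-existsL (tl v) X with add-existsL v X
... | _ , a = _ , tl a

add-functional : ∀ {p X G S S'} → Add p X G S → Add p X G S' → S ≡ S'
add-functionalL : ∀ {i p X hs hs₁ hs₂} → AddL i p X hs hs₁ → AddL i p X hs hs₂ → hs₁ ≡ hs₂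
add-functional here here = refl
add-functional (down a) (down b) = cong (node _ _) (add-functionalL a b)
add-functionalL (hd a) (hd b) = cong (_∷ _) (add-functional a b)
add-functionalL (tl a) (tl b) = cong (_ ∷_) (add-functionalL a b)

validL-++ : ∀ {hs i p} k → ValidL hs i p → ValidL (hs ++ k) i p
validL-++ k (hd v) = hd v
validL-++ k (tl v) = tl (validL-++ k v)

valid-add⁺ : ∀ {a b X G S} → Add a X G S → Valid G b → Valid S b
valid-addL⁺ : ∀ {i a j b X hs hs'} → AddL i a X hs hs' → ValidL hs j b → ValidL hs' j b
valid-add⁺ _ root = root
valid-add⁺ (here {hs = hs}) (down v) = down (validL-++ hs v)
valid-add⁺ (down a) (down v) = down (valid-addL⁺ a v)
valid-addL⁺ (hd a) (hd v) = hd (valid-add⁺ a v)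
valid-addL⁺ (hd a) (tl v) = tl v
valid-addL⁺ (tl a) (hd v) = hd v
valid-addL⁺ (tl a) (tl v) = tl (valid-addL⁺ a v)

valid-add⁻ : ∀ {a b ts fs G S} → Add a (flat ts fs) G S → Valid S b → Valid G b
valid-addL⁻ : ∀ {i a j b ts fs hs hs'} → AddL i a (flat ts fs) hs hs' → ValidL hs' j b → ValidL hs j b
valid-add⁻ _ root = root
valid-add⁻ (here {hs₀ = hs₀}) (down v) rewrite List.++-identityʳ hs₀ = down v
valid-add⁻ (down a) (down v) = down (valid-addL⁻ a v)
valid-addL⁻ (hd a) (hd v) = hd (valid-add⁻ a v)
valid-addL⁻ (hd a) (tl v) = tl v
valid-addL⁻ (tl a) (hd v) = hd v
valid-addL⁻ (tl a) (tl v) = tl (valid-addL⁻ a v)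

addL-++ : ∀ {i q X hs hs'} → AddL i q X hs hs' → ∀ k → AddL i q X (hs ++ k) (hs' ++ k)
addL-++ (hd a) k = hd a
addL-++ (tl a) k = tl (addL-++ a k)

add-comm : ∀ {a b X G S T ts fs} → Add a X G S → Add b (flat ts fs) S T → Valid G b →
           Σ NSeq λ G' → Σ NSeq λ T' → Add b (flat ts fs) G G' × Add a X G' T' × T' ≋ T
add-commL : ∀ {i a j b X hs hs₁ hs₂ ts fs} → AddL i a X hs hs₁ → AddL j b (flat ts fs) hs₁ hs₂ →
            ValidL hs j b →
            Σ (List NSeq) λ hs' → Σ (List NSeq) λ hs₃ →
              AddL j b (flat ts fs) hs hs' × AddL i a X hs' hs₃ × hs₃ ≋* hs₂
add-comm {ts = ts} {fs} (here {ts'} {fs'} {hs} {ts₀} {fs₀} {hs₀}) here _ =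
  _ , _ , here , here ,
  node≋ (++-swapʳ ts₀ ts ts') (++-swapʳ fs₀ fs fs')
        (≋*-reflexive (trans (List.++-assoc hs₀ [] hs) (sym (List.++-identityʳ (hs₀ ++ hs)))))
add-comm (here {hs = hs}) (down a) (down v) with add-existsL v _
... | _ , a' = _ , _ , down a' , here , ≋-reflexive (cong (node _ _) (add-functionalL (addL-++ a' hs) a))
add-comm (down a) here _ = _ , _ , here , down (addL-++ a []) , ≋-refl _
add-comm (down a) (down b) (down v) with add-commL a b v
... | _ , _ , b' , a' , e = _ , _ , down b' , down a' , node≋ ↭-refl ↭-refl e
add-commL (hd a) (hd b) (hd v) with add-comm a b v
... | _ , _ , b' , a' , e = _ , _ , hd b' , hd a' , e ∷ ≋*-refl _
add-commL (hd a) (tl b) (tl v) = _ , _ , tl b , hd a , ≋*-refl _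
add-commL (tl a) (hd b) (hd v) = _ , _ , hd b , tl a , ≋*-refl _
add-commL (tl a) (tl b) (tl v) with add-commL a b v
... | _ , _ , b' , a' , e = _ , _ , tl b' , tl a' , ≋-refl _ ∷ e

merge : NSeq → NSeq → NSeq
merge (node ts fs hs) (node ts' fs' hs') = node (ts ++ ts') (fs ++ fs') (hs ++ hs')

add-merge : ∀ {w X Y G S T T'} → Add w X G S → Add w Y S T → Add w (merge X Y) G T' → T ≋ T'
add-mergeL : ∀ {i w X Y hs hs₁ hs₂ hs₃} → AddL i w X hs hs₁ → AddL i w Y hs₁ hs₂ →
             AddL i w (merge X Y) hs hs₃ → hs₂ ≋* hs₃
add-merge (here {ts} {fs} {hs} {ts₀} {fs₀} {hs₀}) (here {ts'} {fs'} {hs'}) here =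
  node≋ (↭.++-assoc ts₀ ts ts') (↭.++-assoc fs₀ fs fs') (≋*-reflexive (List.++-assoc hs₀ hs hs'))
add-merge (down a) (down b) (down c) = node≋ ↭-refl ↭-refl (add-mergeL a b c)
add-mergeL (hd a) (hd b) (hd c) = add-merge a b c ∷ ≋*-refl _
add-mergeL (tl a) (tl b) (tl c) = ≋-refl _ ∷ add-mergeL a b c

add-cong : ∀ {w X Y G S S'} → X ≋ Y → Add w X G S → Add w Y G S' → S ≋ S'
add-congL : ∀ {i w X Y hs hs₁ hs₂} → X ≋ Y → AddL i w X hs hs₁ → AddL i w Y hs hs₂ → hs₁ ≋* hs₂
add-cong (node≋ p q l) (here {ts₀ = ts₀} {fs₀} {hs₀}) here =
  node≋ (↭.++⁺ˡ ts₀ p) (↭.++⁺ˡ fs₀ q) (≋*-++ (≋*-refl hs₀) l)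
add-cong e (down a) (down b) = node≋ ↭-refl ↭-refl (add-congL e a b)
add-congL e (hd a) (hd b) = add-cong e a b ∷ ≋*-refl _
add-congL e (tl a) (tl b) = ≋-refl _ ∷ add-congL e a b

add-resp-≋ : ∀ {u X G G' S} → G ≋ G' → Add u X G S → Σ NSeq λ S' → Add u X G' S' × S ≋ S'
add-resp-≋L : ∀ {i u X hs hs' hs₁} → hs ≋* hs' → AddL i u X hs hs₁ →
              Σ (List NSeq) λ hs₂ → AddL i u X hs' hs₂ × hs₁ ≋* hs₂
add-resp-≋ (node≋ p q l) (here {ts} {fs} {hs}) =
  _ , here , node≋ (↭.++⁺ʳ ts p) (↭.++⁺ʳ fs q) (≋*-++ l (≋*-refl hs))
add-resp-≋ (node≋ p q l) (down a) with add-resp-≋L l a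
... | _ , b , e = _ , down b , node≋ p q e
add-resp-≋L (e ∷ l) (hd a) with add-resp-≋ e a
... | _ , b , e' = _ , hd b , e' ∷ l
add-resp-≋L (e ∷ l) (tl a) with add-resp-≋L l a
... | _ , b , e' = _ , tl b , e ∷ e'

-- Under ≈ children may be reordered, so the position of the hole changes.
add-reflect-≈ : ∀ {p ts fs S S₀ T} → S₀ ≈ S → Add p (flat ts fs) S T →
                Σ Pos λ p₀ → Σ NSeq λ T₀ → Add p₀ (flat ts fs) S₀ T₀ × T₀ ≈ T
add-reflect-≈L : ∀ {i q ts fs xs ys ys'} → Permutation _≈_ xs ys → AddL i q (flat ts fs) ys ys' →
                 Σ ℕ λ i₀ → Σ Pos λ q₀ → Σ (List NSeq) λ xs' →
                   AddL i₀ q₀ (flat ts fs) xs xs' × Permutation _≈_ xs' ys'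
add-reflect-≈PW : ∀ {i q ts fs xs ys ys'} → Pointwise _≈_ xs ys → AddL i q (flat ts fs) ys ys' →
                  Σ Pos λ q₀ → Σ (List NSeq) λ xs' → AddL i q₀ (flat ts fs) xs xs' × Pointwise _≈_ xs' ys'
add-reflect-≈ {ts = ts} {fs} (node≈ {hs = hs} {hs'} pt pf P) here =
  [] , _ , here ,
  node≈ (↭.++⁺ʳ ts pt) (↭.++⁺ʳ fs pf)
        (subst₂ (Permutation _≈_) (sym (List.++-identityʳ hs)) (sym (List.++-identityʳ hs')) P)
add-reflect-≈ (node≈ pt pf P) (down a) with add-reflect-≈L P a
... | i₀ , q₀ , _ , b , P' = i₀ ∷ q₀ , _ , down b , node≈ pt pf P'
add-reflect-≈L (Perm.refl pw) a with add-reflect-≈PW pw a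
... | q₀ , _ , b , pw' = _ , q₀ , _ , b , Perm.refl pw'
add-reflect-≈L (Perm.prep e P) (hd a) with add-reflect-≈ e a
... | q₀ , _ , b , e' = zero , q₀ , _ , hd b , Perm.prep e' P
add-reflect-≈L (Perm.prep e P) (tl a) with add-reflect-≈L P a
... | i₀ , q₀ , _ , b , P' = suc i₀ , q₀ , _ , tl b , Perm.prep e P'
add-reflect-≈L (Perm.swap e₁ e₂ P) (hd a) with add-reflect-≈ e₂ a
... | q₀ , _ , b , e₂' = suc zero , q₀ , _ , tl (hd b) , Perm.swap e₁ e₂' P
add-reflect-≈L (Perm.swap e₁ e₂ P) (tl (hd a)) with add-reflect-≈ e₁ a
... | q₀ , _ , b , e₁' = zero , q₀ , _ , hd b , Perm.swap e₁' e₂ P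
add-reflect-≈L (Perm.swap e₁ e₂ P) (tl (tl a)) with add-reflect-≈L P a
... | i₀ , q₀ , _ , b , P' = suc (suc i₀) , q₀ , _ , tl (tl b) , Perm.swap e₁ e₂ P'
add-reflect-≈L (Perm.trans P₁ P₂) a with add-reflect-≈L P₂ a
... | _ , _ , _ , b₁ , P₂' with add-reflect-≈L P₁ b₁
... | i₀ , q₀ , _ , b₀ , P₁' = i₀ , q₀ , _ , b₀ , Perm.trans P₁' P₂'
add-reflect-≈PW (e ∷ pw) (hd a) with add-reflect-≈ e a
... | q₀ , _ , b , e' = q₀ , _ , hd b , e' ∷ pw
add-reflect-≈PW (e ∷ pw) (tl a) with add-reflect-≈PW pw a
... | q₀ , _ , b , pw' = q₀ , _ , tl b , e ∷ pw'

walk-map : ∀ {S S' s w u} → (∀ {q} → Valid S q → Valid S' q) → Walk S s w u → Walk S' s w u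
walk-map f (nil v) = nil (f v)
walk-map f (cons (fwd v) wk) = cons (fwd (f v)) (walk-map f wk)
walk-map f (cons (bwd v) wk) = cons (bwd (f v)) (walk-map f wk)

collect : {A : Set} → (List Term → List Fml → List A) → NSeq → List A
collect* : {A : Set} → (List Term → List Fml → List A) → List NSeq → List A
collect k (node ts fs hs) = k ts fs ++ collect* k hs
collect* k [] = []
collect* k (h ∷ hs) = collect k h ++ collect* k hs

collect*-++ : ∀ {A : Set} (k : List Term → List Fml → List A) xs ys →
              collect* k (xs ++ ys) ≡ collect* k xs ++ collect* k ys
collect*-++ k [] ys = refl
collect*-++ k (x ∷ xs) ys =
  trans (cong (collect k x ++_) (collect*-++ k xs ys)) (sym (List.++-assoc (collect k x) _ _))

Additive : {A : Set} → (List Term → List Fml → List A) → Set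
Additive k = ∀ ts ts' fs fs' → k (ts ++ ts') (fs ++ fs') ↭ k ts fs ++ k ts' fs'

collect-add : ∀ {A : Set} {k : List Term → List Fml → List A} {p X G S} → Additive k →
              Add p X G S → collect k S ↭ collect k G ++ collect k X
collect*-addL : ∀ {A : Set} {k : List Term → List Fml → List A} {i p X hs hs'} → Additive k →
                AddL i p X hs hs' → collect* k hs' ↭ collect* k hs ++ collect k X
collect-add {k = k} additive (here {ts} {fs} {hs} {ts₀} {fs₀} {hs₀}) rewrite collect*-++ k hs₀ hs =
  ↭-trans (↭.++⁺ʳ _ (additive ts₀ ts fs₀ fs)) (++-interchange (k ts₀ fs₀) (k ts fs) _ _)
collect-add {k = k} {X = X} additive (down {ts = ts} {fs} {hs} a) =
  ↭-trans (↭.++⁺ˡ (k ts fs) (collect*-addL additive a)) (++-assoc↭ (k ts fs) (collect* k hs) (collect k X))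
collect*-addL {k = k} additive (hd {h = h} {hs = hs} a) =
  ↭-trans (↭.++⁺ʳ _ (collect-add additive a)) (++-swapʳ (collect k h) _ (collect* k hs))
collect*-addL {k = k} additive (tl {h = h} a) =
  ↭-trans (↭.++⁺ˡ (collect k h) (collect*-addL additive a)) (++-assoc↭ (collect k h) _ _)

collect-resp-≈ : ∀ {A : Set} {k : List Term → List Fml → List A} →
                 (∀ {ts ts' fs fs'} → ts ↭ ts' → fs ↭ fs' → k ts fs ↭ k ts' fs') →
                 ∀ {S S'} → S ≈ S' → collect k S ↭ collect k S'
collect*-resp-≈ : ∀ {A : Set} {k : List Term → List Fml → List A} →
                  (∀ {ts ts' fs fs'} → ts ↭ ts' → fs ↭ fs' → k ts fs ↭ k ts' fs') →
                  ∀ {hs hs'} → Permutation _≈_ hs hs' → collect* k hs ↭ collect* k hs'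
collect*-resp-Pointwise : ∀ {A : Set} {k : List Term → List Fml → List A} →
                          (∀ {ts ts' fs fs'} → ts ↭ ts' → fs ↭ fs' → k ts fs ↭ k ts' fs') →
                          ∀ {hs hs'} → Pointwise _≈_ hs hs' → collect* k hs ↭ collect* k hs'
collect-resp-≈ resp (node≈ p q P) = ↭.++⁺ (resp p q) (collect*-resp-≈ resp P)
collect*-resp-≈ resp (Perm.refl pw) = collect*-resp-Pointwise resp pw
collect*-resp-≈ resp (Perm.prep e P) = ↭.++⁺ (collect-resp-≈ resp e) (collect*-resp-≈ resp P)
collect*-resp-≈ {k = k} resp (Perm.swap {x′ = x′} {y′} e₁ e₂ P) =
  ↭-trans (↭.++⁺ (collect-resp-≈ resp e₁) (↭.++⁺ (collect-resp-≈ resp e₂) (collect*-resp-≈ resp P)))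
          (↭.shifts (collect k x′) (collect k y′))
collect*-resp-≈ resp (Perm.trans P₁ P₂) = ↭-trans (collect*-resp-≈ resp P₁) (collect*-resp-≈ resp P₂)
collect*-resp-Pointwise resp [] = ↭-refl
collect*-resp-Pointwise resp (e ∷ pw) = ↭.++⁺ (collect-resp-≈ resp e) (collect*-resp-Pointwise resp pw)

formulas : NSeq → List Fml
formulas = collect (λ _ fs → fs)

formulas-add : ∀ {p X G S} → Add p X G S → formulas S ↭ formulas G ++ formulas X
formulas-add = collect-add (λ _ _ _ _ → ↭-refl)

∈-formulas-add⁺ : ∀ {g p X G S} → Add p X G S → g ∈ formulas G ⊎ g ∈ formulas X → g ∈ formulas S
∈-formulas-add⁺ a = ↭.∈-resp-↭ (↭-sym (formulas-add a)) ∘ [ ∈-++⁺ˡ , ∈-++⁺ʳ _ ]′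

∈-formulas-add⁻ : ∀ {g p X G S} → Add p X G S → g ∈ formulas S → g ∈ formulas G ⊎ g ∈ formulas X
∈-formulas-add⁻ a = ∈-++⁻ _ ∘ ↭.∈-resp-↭ (formulas-add a)

∈-formulas-reflect-≈ : ∀ {g S S'} → S ≈ S' → g ∈ formulas S' → g ∈ formulas S
∈-formulas-reflect-≈ e = ↭.∈-resp-↭ (↭-sym (collect-resp-≈ (λ _ q → q) e))

fvNode : List Term → List Fml → List ℕ
fvNode ts fs = concatMap fvTerm ts ++ concatMap fvF fs

fvS≡collect : ∀ S → fvS S ≡ collect fvNode S
fvSs≡collect* : ∀ hs → fvSs hs ≡ collect* fvNode hs
fvS≡collect (node ts fs hs) =
  trans (cong (λ l → concatMap fvTerm ts ++ concatMap fvF fs ++ l) (fvSs≡collect* hs))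
        (sym (List.++-assoc (concatMap fvTerm ts) _ _))
fvSs≡collect* [] = refl
fvSs≡collect* (h ∷ hs) = cong₂ _++_ (fvS≡collect h) (fvSs≡collect* hs)

fvNode-additive : Additive fvNode
fvNode-additive ts ts' fs fs' rewrite List.concatMap-++ fvTerm ts ts' | List.concatMap-++ fvF fs fs' =
  ++-interchange (concatMap fvTerm ts) _ _ _

fvS-add : ∀ {p X G S} → Add p X G S → fvS S ↭ fvS G ++ fvS X
fvS-add {X = X} {G} {S} a rewrite fvS≡collect S | fvS≡collect G | fvS≡collect X =
  collect-add fvNode-additive a

∈-fvS-add⁺ : ∀ {y p X G S} → Add p X G S → y ∈ fvS G ⊎ y ∈ fvS X → y ∈ fvS S
∈-fvS-add⁺ a = ↭.∈-resp-↭ (↭-sym (fvS-add a)) ∘ [ ∈-++⁺ˡ , ∈-++⁺ʳ _ ]′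

∈-fvS-add⁻ : ∀ {y p X G S} → Add p X G S → y ∈ fvS S → y ∈ fvS G ⊎ y ∈ fvS X
∈-fvS-add⁻ a = ∈-++⁻ _ ∘ ↭.∈-resp-↭ (fvS-add a)

fvF⊆fvS : ∀ {g S} → g ∈ formulas S → fvF g ⊆ fvS S
fvF⊆fvSs : ∀ {g hs} → g ∈ collect* (λ _ fs → fs) hs → fvF g ⊆ fvSs hs
fvF⊆fvS {S = node ts fs hs} o m with ∈-++⁻ fs o
... | inj₁ g∈fs = ∈-++⁺ʳ (concatMap fvTerm ts) (∈-++⁺ˡ (∈-concatMap⁺ fvF (Any.map (λ { refl → m }) g∈fs)))
... | inj₂ g∈hs = ∈-++⁺ʳ (concatMap fvTerm ts) (∈-++⁺ʳ (concatMap fvF fs) (fvF⊆fvSs {hs = hs} g∈hs m))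
fvF⊆fvSs {hs = h ∷ hs} o m with ∈-++⁻ (formulas h) o
... | inj₁ o' = ∈-++⁺ˡ (fvF⊆fvS {S = h} o' m)
... | inj₂ o' = ∈-++⁺ʳ (fvS h) (fvF⊆fvSs {hs = hs} o' m)

module Weakening {𝒞 : CondSet} {g : Fml} (g-literal : IsLiteral g)
                 {ts : List Term} {fs : List Fml} (fv⊆ : fvS (flat ts fs) ⊆ fvF g) where

  Δ : NSeq
  Δ = flat ts fs

  fvΔ⊆fvS : ∀ S → g ∈ formulas S → fvS Δ ⊆ fvS S
  fvΔ⊆fvS S o m = fvF⊆fvS {S = S} o (fv⊆ m)

  not-principal : ∀ {φ} {fx : List Fml} → ¬ IsLiteral φ → g ∈ φ ∷ [] → g ∈ fx
  not-principal ¬literal (here refl) = ⊥-elim (¬literal g-literal)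

  occurs-in-premise : ∀ {w tx fx tx' fx' hx' G S S'} →
    Add w (flat tx fx) G S → Add w (node tx' fx' hx') G S' →
    g ∈ formulas S → (g ∈ fx → g ∈ fx') → g ∈ formulas S'
  occurs-in-premise a a' o kept with ∈-formulas-add⁻ a o
  ... | inj₁ o' = ∈-formulas-add⁺ a' (inj₁ o')
  ... | inj₂ o' = ∈-formulas-add⁺ a' (inj₂ (∈-++⁺ˡ (kept ([ id , (λ ()) ]′ (∈-++⁻ _ o')))))

  commute-principal : ∀ {w p tx fx G S T} → Add w (flat tx fx) G S → Add p Δ S T →
    Σ NSeq λ G' → Σ NSeq λ T' → Add p Δ G G' × Add w (flat tx fx) G' T' × T' ≋ T
  commute-principal a ad = add-comm a ad (valid-add⁻ a (add-valid ad))

  weaken-premise : ∀ {p w Y A A' B} → Add p Δ A A' → Add w Y A B →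
    (∀ {B'} → Add p Δ B B' → Prov 𝒞 B') → Σ NSeq λ B'' → Add w Y A' B'' × Prov 𝒞 B''
  weaken-premise aΔ aY ih with add-exists (valid-add⁺ aY (add-valid aΔ)) Δ
  ... | _ , aΔ' with add-comm aY aΔ' (add-valid aΔ)
  ... | _ , B'' , aΔ'' , aY' , e =
    B'' , ≡-subst (λ A → Add _ _ A B'') (add-functional aΔ'' aΔ) aY' , mset (≋⇒≈ (≋-sym e)) (ih aΔ')

  weaken-premise≋ : ∀ {p w Y A A' A'' B} → A'' ≋ A' → Add p Δ A A' → Add w Y A B →
    (∀ {B'} → Add p Δ B B' → Prov 𝒞 B') → Σ NSeq λ B'' → Add w Y A'' B'' × Prov 𝒞 B''
  weaken-premise≋ e aΔ aY ih with weaken-premise aΔ aY ih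
  ... | _ , aY' , π with add-resp-≋ (≋-sym e) aY'
  ... | _ , aY'' , e' = _ , aY'' , mset (≋⇒≈ e') π

  weaken : ∀ {S p T} → Prov 𝒞 S → g ∈ formulas S → Add p Δ S T → Prov 𝒞 T
  weaken (ax l a) o ad with commute-principal a ad
  ... | _ , _ , _ , b , e = mset (≋⇒≈ e) (ax l b)
  weaken (∨R a a₁ π) o ad with commute-principal a ad
  ... | _ , _ , aG , b , e with weaken-premise aG a₁ (weaken π (occurs-in-premise a a₁ o (not-principal λ ())))
  ... | _ , b₁ , π' = mset (≋⇒≈ e) (∨R b b₁ π')
  weaken (∧R a a₁ a₂ π₁ π₂) o ad with commute-principal a ad
  ... | _ , _ , aG , b , e
    with weaken-premise aG a₁ (weaken π₁ (occurs-in-premise a a₁ o (not-principal λ ())))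
       | weaken-premise aG a₂ (weaken π₂ (occurs-in-premise a a₂ o (not-principal λ ())))
  ... | _ , b₁ , π₁' | _ , b₂ , π₂' = mset (≋⇒≈ e) (∧R b b₁ b₂ π₁' π₂')
  weaken (∃R a a₁ π) o ad with commute-principal a ad
  ... | _ , _ , aG , b , e with weaken-premise aG a₁ (weaken π (occurs-in-premise a a₁ o (not-principal λ ())))
  ... | _ , b₁ , π' = mset (≋⇒≈ e) (∃R b b₁ π')
  weaken {S} (∀R {y = y} a a₁ y∉ π) o ad with commute-principal a ad
  ... | _ , T₁ , aG , b , e with weaken-premise aG a₁ (weaken π (occurs-in-premise a a₁ o (not-principal λ ())))
  ... | _ , b₁ , π' = mset (≋⇒≈ e) (∀R b b₁ y∉T₁ π')
    where
      y∉T₁ : y ∉ fvS T₁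
      y∉T₁ m with ∈-fvS-add⁻ b m
      ... | inj₂ m' = y∉ (∈-fvS-add⁺ a (inj₂ m'))
      ... | inj₁ m' with ∈-fvS-add⁻ aG m'
      ...   | inj₁ m'' = y∉ (∈-fvS-add⁺ a (inj₁ m''))
      ...   | inj₂ m'' = y∉ (fvΔ⊆fvS S o m'')
  weaken (◇R a wk ℓ a₁ π) o ad with commute-principal a ad
  ... | _ , _ , aG , b , e with weaken-premise≋ e ad a₁ (weaken π (∈-formulas-add⁺ a₁ (inj₁ o)))
  ... | _ , b₁ , π' =
    mset (≋⇒≈ e) (◇R b (walk-map (valid-add⁺ b ∘ valid-add⁺ aG ∘ valid-add⁻ a) wk) ℓ b₁ π')
  weaken (□R a a₁ π) o ad with commute-principal a ad
  ... | _ , _ , aG , b , e with weaken-premise aG a₁ (weaken π (occurs-in-premise a a₁ o (not-principal λ ())))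
  ... | _ , b₁ , π' = mset (≋⇒≈ e) (□R b b₁ π')
  weaken (ref a₁ π) o ad with weaken-premise ad a₁ (weaken π (∈-formulas-add⁺ a₁ (inj₁ o)))
  ... | _ , b₁ , π' = ref b₁ π'
  weaken (rep l a a₁ π) o ad with commute-principal a ad
  ... | _ , _ , aG , b , e with weaken-premise aG a₁ (weaken π (occurs-in-premise a a₁ o ∈-++⁺ˡ))
  ... | _ , b₁ , π' = mset (≋⇒≈ e) (rep l b b₁ π')
  weaken (drep a a₁ π) o ad with commute-principal a ad
  ... | _ , _ , aG , b , e with weaken-premise aG a₁ (weaken π (occurs-in-premise a a₁ o id))
  ... | _ , b₁ , π' = mset (≋⇒≈ e) (drep b b₁ π')
  weaken (rig w≢u a a₁ π) o ad with commute-principal a ad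
  ... | _ , _ , aG , b , e with weaken-premise≋ e ad a₁ (weaken π (∈-formulas-add⁺ a₁ (inj₁ o)))
  ... | _ , b₁ , π' = mset (≋⇒≈ e) (rig w≢u b b₁ π')
  weaken (dp w≢u a wk ℓ a₁ π) o ad with commute-principal a ad
  ... | _ , _ , aG , b , e with weaken-premise≋ e ad a₁ (weaken π (∈-formulas-add⁺ a₁ (inj₁ o)))
  ... | _ , b₁ , π' =
    mset (≋⇒≈ e) (dp w≢u b (walk-map (valid-add⁺ b ∘ valid-add⁺ aG ∘ valid-add⁻ a) wk) ℓ b₁ π')
  weaken (d cD a₁ π) o ad with weaken-premise ad a₁ (weaken π (∈-formulas-add⁺ a₁ (inj₁ o)))
  ... | _ , b₁ , π' = d cD b₁ π'
  weaken {S} (nd cNE y∉ a₁ π) o ad with weaken-premise ad a₁ (weaken π (∈-formulas-add⁺ a₁ (inj₁ o)))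
  ... | _ , b₁ , π' = nd cNE (λ m → y∉ ([ id , fvΔ⊆fvS S o ]′ (∈-fvS-add⁻ ad m))) b₁ π'
  weaken (cd cCD a₁ π) o ad with weaken-premise ad a₁ (weaken π (∈-formulas-add⁺ a₁ (inj₁ o)))
  ... | _ , b₁ , π' = cd cCD b₁ π'
  weaken (mset e π) o ad with add-reflect-≈ e ad
  ... | _ , _ , ad₀ , e₀ = mset e₀ (weaken π (∈-formulas-reflect-≈ e o) ad₀)

open Weakening using (weaken)

ProvAt : CondSet → Pos → NSeq → List Fml → Set
ProvAt 𝒞 w G fs = ∀ {S} → Add w (flat [] fs) G S → Prov 𝒞 S

Prov⇒ProvAt : ∀ {𝒞 w G fs S} → Add w (flat [] fs) G S → Prov 𝒞 S → ProvAt 𝒞 w G fs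
Prov⇒ProvAt a π a' = ≡-subst (Prov _) (add-functional a a') π

ProvAt-resp-↭ : ∀ {𝒞 w G fs fs'} → fs ↭ fs' → ProvAt 𝒞 w G fs → ProvAt 𝒞 w G fs'
ProvAt-resp-↭ {fs = fs} p prem a with add-exists (add-valid a) (flat [] fs)
... | _ , a' = mset (≋⇒≈ (add-cong (node≋ ↭-refl p []) a' a)) (prem a')

weaken-at : ∀ {𝒞 w G g fs fs'} → IsLiteral g → g ∈ fs → fvS (flat [] fs') ⊆ fvF g →
            ProvAt 𝒞 w G fs → ProvAt 𝒞 w G (fs ++ fs')
weaken-at {fs = fs} {fs'} g-literal g∈fs fv⊆ prem a with add-exists (add-valid a) (flat [] fs)
... | _ , aS with add-exists (valid-add⁺ aS (add-valid aS)) (flat [] fs')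
... | _ , aT =
  mset (≋⇒≈ (add-merge aS aT a))
       (weaken g-literal fv⊆ (prem aS) (∈-formulas-add⁺ aS (inj₂ (∈-++⁺ˡ g∈fs))) aT)

ref-at : ∀ {𝒞 w G fs t} → ProvAt 𝒞 w G (fs ++ t ≠ t ∷ []) → ProvAt 𝒞 w G fs
ref-at {fs = fs} {t} prem a with add-exists (valid-add⁺ a (add-valid a)) (flat [] (t ≠ t ∷ []))
... | _ , a₁ with add-exists (add-valid a) (flat [] (fs ++ t ≠ t ∷ []))
... | _ , a₂ = ref a₁ (mset (≋⇒≈ (≋-sym (add-merge a a₁ a₂))) (prem a₂))

rep-at : ∀ {𝒞 w G t s N z φ ψ} → IsNegLiteral N → subst N z t ≡ φ → subst N z s ≡ ψ →
         ProvAt 𝒞 w G (t ≠ s ∷ φ ∷ ψ ∷ []) → ProvAt 𝒞 w G (t ≠ s ∷ φ ∷ [])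
rep-at {t = t} {s} {φ = φ} {ψ} negative refl refl prem a
  with add-exists (add-valid a) (flat [] (t ≠ s ∷ φ ∷ ψ ∷ []))
... | _ , a' = rep negative a a' (prem a')

fresh : Term → ℕ
fresh (var y) = suc y
fresh (con c) = 0

≡ᵇ-refl : ∀ n → (n ≡ᵇ n) ≡ true
≡ᵇ-refl zero = refl
≡ᵇ-refl (suc n) = ≡ᵇ-refl n

≡ᵇ-suc : ∀ n → (n ≡ᵇ suc n) ≡ false
≡ᵇ-suc zero = refl
≡ᵇ-suc (suc n) = ≡ᵇ-suc n

substTm-fresh : ∀ t u → substTm {0} (fresh t) u (fr t) ≡ fr t
substTm-fresh (var y) u rewrite ≡ᵇ-suc y = refl
substTm-fresh (con c) u = refl

substTm-self : ∀ z u → substTm {0} z u (fr (var z)) ≡ fr u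
substTm-self z u rewrite ≡ᵇ-refl z = refl

rep-left-at : ∀ {𝒞 w G t s u} →
              ProvAt 𝒞 w G (t ≠ s ∷ t ≠ u ∷ s ≠ u ∷ []) → ProvAt 𝒞 w G (t ≠ s ∷ t ≠ u ∷ [])
rep-left-at {t = t} {s} {u} = rep-at {N = var z ≠ u} {z = z} (n-neq _ _) N[ t ] N[ s ]
  where
    z = fresh u
    N[_] : ∀ v → subst (var z ≠ u) z v ≡ v ≠ u
    N[ v ] = cong₂ neq (substTm-self z v) (substTm-fresh u v)

rep-right-at : ∀ {𝒞 w G t s u} →
               ProvAt 𝒞 w G (t ≠ s ∷ u ≠ t ∷ u ≠ s ∷ []) → ProvAt 𝒞 w G (t ≠ s ∷ u ≠ t ∷ [])
rep-right-at {t = t} {s} {u} = rep-at {N = u ≠ var z} {z = z} (n-neq _ _) N[ t ] N[ s ]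
  where
    z = fresh u
    N[_] : ∀ v → subst (u ≠ var z) z v ≡ u ≠ v
    N[ v ] = cong₂ neq (substTm-fresh u v) (substTm-self z v)

fv-t≠t⊆fv-t≠s : ∀ t s → fvS (flat [] (t ≠ t ∷ [])) ⊆ fvF (t ≠ s)
fv-t≠t⊆fv-t≠s t s m with ∈-++⁻ (fvF (t ≠ t) ++ []) m
... | inj₂ ()
... | inj₁ m' with ∈-++⁻ (fvF (t ≠ t)) m'
...   | inj₂ ()
...   | inj₁ m'' = ∈-++⁺ˡ ([ id , id ]′ (∈-++⁻ (fvTerm t) m''))

sym-at : ∀ {𝒞 w G t s} → ProvAt 𝒞 w G (t ≠ s ∷ s ≠ t ∷ []) → ProvAt 𝒞 w G (t ≠ s ∷ [])
sym-at {t = t} {s} =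
    ref-at
  ∘ rep-left-at
  ∘ ProvAt-resp-↭ (↭-prep _ (↭-swap _ _ ↭-refl))
  ∘ weaken-at (l-neq _ _) (here refl) (fv-t≠t⊆fv-t≠s t s)

tra-at : ∀ {𝒞 w G t s r} → ProvAt 𝒞 w G (t ≠ s ∷ s ≠ r ∷ t ≠ r ∷ []) → ProvAt 𝒞 w G (t ≠ s ∷ s ≠ r ∷ [])
tra-at = ProvAt-resp-↭ (↭-swap _ _ ↭-refl) ∘ rep-right-at ∘ ProvAt-resp-↭ (↭-swap _ _ ↭-refl)

mainTheorem11 : (𝒞 : CondSet) → Closed 𝒞 → SymAdmissible 𝒞 × TraAdmissible 𝒞
mainTheorem11 𝒞 _ =
    (λ w G S S' t s premise conclusion π → sym-at (Prov⇒ProvAt premise π) conclusion)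
  , (λ w G S S' t s r premise conclusion π → tra-at (Prov⇒ProvAt premise π) conclusion)
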